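{- If $(\mathsf{e},\gamma)$ and $(\mathsf{e}',\gamma')$ are actual events and $\mathsf{e}\le\mathsf{e}'$, then $\mathbb{P}(\mathsf{e},\gamma)\le\mathbb{P}(\mathsf{e}',\gamma')$.
   Context: A potential event is a sequence $\mathsf{e}:\mathbb{N}^{+}\to\{0,1\}$; $\mathsf{e}\le\mathsf{e}'$ iff $\mathsf{e}(n)\le\mathsf{e}'(n)$ for all $n$. Define $\Phi(\mathsf{e})(n)=\frac{\sum_{i=1}^{n}\mathsf{e}(i)}{n}$. An actual event is a pair $(\mathsf{e},\gamma)$ with $\gamma:\mathbb{N}^{+}\to\mathbb{N}^{+}$ strictly increasing and $|\Phi(\mathsf{e})(\gamma(n)+i)-\Phi(\mathsf{e})(\gamma(n)+j)|\le\frac1n$ for all $n\in\mathbb{N}^{+}$, $i,j\in\mathbb{N}$; $\mathbb{P}(\mathsf{e},\gamma):=\Phi(\mathsf{e})\circ\gamma$. Bishop reals are sequences $x:\mathbb{N}^{+}\to\mathbb{Q}$ with $|x(n)-x(m)|\le\frac1n+\frac1m$. Order is Bishop's: $(x-y)(n)=x(2n)-y(2n)$, and $x\le y$ iff $(x-y)(n)\le\frac1n$ for all $n\in\mathbb{N}^{+}$. -}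

module Defs where

open import Data.Nat as ℕ using (ℕ; zero; suc)
open import Data.Bool using (Bool; true; false)
open import Data.Integer using (+_)
open import Data.Rational using (ℚ; _/_; _-_; ∣_∣; _≤_)
open import Data.Product using (Σ; _×_)

-- Convention: ℕ⁺ is represented as a record wrapping a natural k, standing for k+1.
record ℕ⁺ : Set where
  constructor 1+
  field pred : ℕ

open ℕ⁺ public

⟦_⟧ : ℕ⁺ → ℕ
⟦ 1+ k ⟧ = suc k

_+⁺_ : ℕ⁺ → ℕ → ℕ⁺
1+ k +⁺ i = 1+ (k ℕ.+ i)

2*⁺ : ℕ⁺ → ℕ⁺
2*⁺ (1+ k) = 1+ (suc (2 ℕ.* k))

_<⁺_ : ℕ⁺ → ℕ⁺ → Set
m <⁺ n = ⟦ m ⟧ ℕ.< ⟦ n ⟧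

b2n : Bool → ℕ
b2n true = 1
b2n false = 0

Event : Set
Event = ℕ⁺ → Bool

_≤ₑ_ : Event → Event → Set
e ≤ₑ e' = ∀ n → b2n (e n) ℕ.≤ b2n (e' n)

count : Event → ℕ → ℕ
count e zero = 0
count e (suc m) = count e m ℕ.+ b2n (e (1+ m))

Φ : Event → ℕ⁺ → ℚ
Φ e (1+ k) = (+ count e (suc k)) / suc k

inv : ℕ⁺ → ℚ
inv (1+ k) = (+ 1) / suc k

StrictlyIncreasing : (ℕ⁺ → ℕ⁺) → Set
StrictlyIncreasing γ = ∀ m n → m <⁺ n → γ m <⁺ γ n

IsActualEvent : Event → (ℕ⁺ → ℕ⁺) → Set
IsActualEvent e γ =
  StrictlyIncreasing γ ×
  (∀ (n : ℕ⁺) (i j : ℕ) → ∣ Φ e (γ n +⁺ i) - Φ e (γ n +⁺ j) ∣ ≤ inv n)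

ℙ : Event → (ℕ⁺ → ℕ⁺) → ℕ⁺ → ℚ
ℙ e γ n = Φ e (γ n)

IsBishopReal : (ℕ⁺ → ℚ) → Set
IsBishopReal x = ∀ n m → ∣ x n - x m ∣ ≤ inv n Data.Rational.+ inv m

_-ᵣ_ : (ℕ⁺ → ℚ) → (ℕ⁺ → ℚ) → ℕ⁺ → ℚ
(x -ᵣ y) n = x (2*⁺ n) - y (2*⁺ n)

_≤ᵣ_ : (ℕ⁺ → ℚ) → (ℕ⁺ → ℚ) → Set
x ≤ᵣ y = ∀ n → (x -ᵣ y) n ≤ inv n

-- By monotonicity of Φ, e ≤ e' gives Φ e N ≤ Φ e' N at every N. Evaluating ℙ at 2n compares
-- Φ e and Φ e' at the points a = γ (2n) and b = γ' (2n); both sequences have settled to within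
-- 1/(2n) beyond their respective points, so at a common later point N each can be replaced by its
-- value at N at a cost of 1/(2n), giving ℙ e γ (2n) − ℙ e' γ' (2n) ≤ 1/(2n) + 1/(2n) = 1/n.
module Submission where

open import Defs
open import Data.Nat as ℕ using (ℕ; zero; suc)
import Data.Nat.Properties as ℕ
import Data.Nat.Tactic.RingSolver as ℕ-Solver
open import Data.Integer as ℤ using (+_)
import Data.Integer.Properties as ℤ
open import Data.Rational
open import Data.Rational.Properties
open import Data.Rational.Solver using (module +-*-Solver)
import Data.Rational.Unnormalised as ℚᵘ
import Data.Rational.Unnormalised.Properties as ℚᵘ
open import Data.List using (_∷_; [])
open import Data.Product using (proj₂)
open import Data.Sum using (inj₁; inj₂)
open import Relation.Binary.PropositionalEquality

p≤∣p∣ : ∀ p → p ≤ ∣ p ∣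
p≤∣p∣ p with ≤-total 0ℚ p
... | inj₁ 0≤p = ≤-reflexive (sym (0≤p⇒∣p∣≡p 0≤p))
... | inj₂ p≤0 = ≤-trans p≤0 (0≤∣p∣ p)

p≤q⇒p-q≤0 : ∀ {p q} → p ≤ q → p - q ≤ 0ℚ
p≤q⇒p-q≤0 {p} {q} p≤q = subst (p - q ≤_) (+-inverseʳ q) (+-monoˡ-≤ (- q) p≤q)

x-y≤h+h-via-≤ : ∀ x y {X Y} h → ∣ x - X ∣ ≤ h → X ≤ Y → ∣ Y - y ∣ ≤ h → x - y ≤ h + h
x-y≤h+h-via-≤ x y {X} {Y} h ∣x-X∣≤h X≤Y ∣Y-y∣≤h = begin
  x - y                              ≡⟨ telescope x y X Y ⟩
  (x - X) + ((X - Y) + (Y - y))      ≤⟨ +-mono-≤ (≤-trans (p≤∣p∣ _) ∣x-X∣≤h)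
                                          (+-mono-≤ (p≤q⇒p-q≤0 X≤Y) (≤-trans (p≤∣p∣ _) ∣Y-y∣≤h)) ⟩
  h + (0ℚ + h)                       ≡⟨ cong (λ z → h + z) (+-identityˡ h) ⟩
  h + h                              ∎
  where
  open ≤-Reasoning
  open +-*-Solver
  telescope : ∀ x y X Y → x - y ≡ (x - X) + ((X - Y) + (Y - y))
  telescope = solve 4 (λ x y X Y → x :- y := (x :- X) :+ ((X :- Y) :+ (Y :- y))) refl

count-mono : ∀ {e e'} → e ≤ₑ e' → ∀ m → count e m ℕ.≤ count e' m
count-mono e≤e' zero    = ℕ.z≤n
count-mono e≤e' (suc m) = ℕ.+-mono-≤ (count-mono e≤e' m) (e≤e' (1+ m))

+c/d-monoˡ-≤ : ∀ {c c'} d → c ℕ.≤ c' → (+ c) / suc d ≤ (+ c') / suc d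
+c/d-monoˡ-≤ {c} {c'} d c≤c' = toℚᵘ-cancel-≤ (begin
  toℚᵘ (fromℚᵘ (ℚᵘ.mkℚᵘ (+ c) d))    ≃⟨ toℚᵘ-fromℚᵘ _ ⟩
  ℚᵘ.mkℚᵘ (+ c) d                    ≤⟨ ℚᵘ.*≤* (ℤ.*-monoʳ-≤-nonNeg (+ suc d) (ℤ.+≤+ c≤c')) ⟩
  ℚᵘ.mkℚᵘ (+ c') d                   ≃⟨ toℚᵘ-fromℚᵘ _ ⟨
  toℚᵘ (fromℚᵘ (ℚᵘ.mkℚᵘ (+ c') d))   ∎)
  where open ℚᵘ.≤-Reasoning

Φ-mono : ∀ {e e'} → e ≤ₑ e' → ∀ a → Φ e a ≤ Φ e' a
Φ-mono e≤e' (1+ k) = +c/d-monoˡ-≤ k (count-mono e≤e' (suc k))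

+⁺-identityʳ : ∀ a → a +⁺ 0 ≡ a
+⁺-identityʳ (1+ k) = cong 1+ (ℕ.+-identityʳ k)

+⁺-pred-comm : ∀ a b → a +⁺ pred b ≡ b +⁺ pred a
+⁺-pred-comm (1+ k) (1+ l) = cong 1+ (ℕ.+-comm k l)

inv-2*⁺-half : ∀ n → inv (2*⁺ n) + inv (2*⁺ n) ≡ inv n
inv-2*⁺-half (1+ k) = toℚᵘ-injective (begin
  toℚᵘ (h + h)                       ≈⟨ toℚᵘ-homo-+ h h ⟩
  toℚᵘ h ℚᵘ.+ toℚᵘ h                 ≈⟨ ℚᵘ.+-cong (toℚᵘ-fromℚᵘ u) (toℚᵘ-fromℚᵘ u) ⟩
  u ℚᵘ.+ u                           ≈⟨ ℚᵘ.*≡* (cong +_ (ℕ-Solver.solve (k ∷ []))) ⟩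
  ℚᵘ.mkℚᵘ (+ 1) k                    ≈⟨ toℚᵘ-fromℚᵘ _ ⟨
  toℚᵘ (inv (1+ k))                  ∎)
  where
  open ℚᵘ.≃-Reasoning
  u = ℚᵘ.mkℚᵘ (+ 1) (suc (2 ℕ.* k))
  h = inv (2*⁺ (1+ k))

SettledBeyond : Event → ℕ⁺ → ℚ → Set
SettledBeyond e a h = ∀ i j → ∣ Φ e (a +⁺ i) - Φ e (a +⁺ j) ∣ ≤ h

Φ-settled-≤ : ∀ {e e'} a b h → e ≤ₑ e' →
  SettledBeyond e a h → SettledBeyond e' b h → Φ e a - Φ e' b ≤ h + h
Φ-settled-≤ {e} {e'} a b h e≤e' settled settled' =
  x-y≤h+h-via-≤ (Φ e a) (Φ e' b) h near-a (Φ-mono e≤e' (a +⁺ pred b)) near-b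
  where
  near-a : ∣ Φ e a - Φ e (a +⁺ pred b) ∣ ≤ h
  near-a = subst (λ c → ∣ Φ e c - Φ e (a +⁺ pred b) ∣ ≤ h) (+⁺-identityʳ a) (settled 0 (pred b))
  near-b : ∣ Φ e' (a +⁺ pred b) - Φ e' b ∣ ≤ h
  near-b = subst₂ (λ c d → ∣ Φ e' c - Φ e' d ∣ ≤ h)
    (sym (+⁺-pred-comm a b)) (+⁺-identityʳ b) (settled' (pred a) 0)

mainTheorem9 : ∀ (e e' : Event) (γ γ' : ℕ⁺ → ℕ⁺) →
    IsActualEvent e γ → IsActualEvent e' γ' → e ≤ₑ e' →
    ℙ e γ ≤ᵣ ℙ e' γ'
mainTheorem9 e e' γ γ' actual actual' e≤e' n =
  subst (ℙ e γ (2*⁺ n) - ℙ e' γ' (2*⁺ n) ≤_) (inv-2*⁺-half n)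
    (Φ-settled-≤ (γ (2*⁺ n)) (γ' (2*⁺ n)) (inv (2*⁺ n)) e≤e'
      (proj₂ actual (2*⁺ n)) (proj₂ actual' (2*⁺ n)))
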